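{- Let $R$ be a principal ideal domain of characteristic different from $2$, and let $\Delta\in R$ with $\Delta\equiv\pi^2\pmod{4R}$ for some $\pi\in R$. Let $H_0$ be the set of values in $(R/\Delta R)^\times$ of the principal form class. Then $H_0$ is a subgroup of $(R/\Delta R)^\times$ containing the subgroup of squares $(R/\Delta R)^{\times\square}$. Moreover, if $2$ is invertible in $R/\Delta R$, then $H_0=R^\times\,(R/\Delta R)^{\times\square}$, where $R^\times$ denotes the image of the units of $R$ in $R/\Delta R$.
   Context: Binary quadratic forms over $R$ are $[a,b,c]:=ax^2+bxy+cy^2$, primitive if $\langle a,b,c\rangle=R$, with discriminant $b^2-4ac$. The twisted action of $M=\begin{pmatrix}\alpha&\beta\\ \gamma&\delta\end{pmatrix}\in\mathrm{GL}_2(R)$ is $(M\cdot q)(x,y):=\frac{1}{\alpha\delta-\beta\gamma}q(\alpha x+\beta y,\gamma x+\delta y)$, and forms are equivalent if related by this action. The principal form class is the equivalence class of $[1,\pi,-\frac{\Delta-\pi^2}{4}]$ (independent of the choice of $\pi$ with $\Delta\equiv\pi^2 \bmod 4R$). For a primitive form $q$ of discriminant $\Delta$, $\mathrm{val}_\Delta(q):=\{q(x,y): x,y\in R/\Delta R\}\cap(R/\Delta R)^\times$, and the set of values of the class of $q$ in $(R/\Delta R)^\times$ is $H_q:=\bigcup_{q'\sim q}\mathrm{val}_\Delta(q')$. -}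

module Defs where

open import Level using (Level; _⊔_; suc)
open import Algebra.Bundles using (CommutativeRing)
open import Data.Product using (Σ; ∃; ∃-syntax; _×_; _,_)
open import Data.Sum using (_⊎_)
open import Relation.Nullary using (¬_)

module _ {c ℓ : Level} (R : CommutativeRing c ℓ) where
  open CommutativeRing R

  two : Carrier
  two = 1# + 1#

  four : Carrier
  four = two * two

  Divides : Carrier → Carrier → Set (c ⊔ ℓ)
  Divides a b = ∃[ k ] (k * a ≈ b)

  IsUnit : Carrier → Set (c ⊔ ℓ)
  IsUnit x = ∃[ y ] (x * y ≈ 1#)

  IsIntegralDomain : Set (c ⊔ ℓ)
  IsIntegralDomain = (¬ (1# ≈ 0#)) × (∀ x y → x * y ≈ 0# → (x ≈ 0#) ⊎ (y ≈ 0#))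

  record IsIdeal (I : Carrier → Set (c ⊔ ℓ)) : Set (c ⊔ ℓ) where
    field
      resp : ∀ {x y} → x ≈ y → I x → I y
      has-0 : I 0#
      closed-+ : ∀ {x y} → I x → I y → I (x + y)
      closed-* : ∀ r {x} → I x → I (r * x)

  IsPrincipalIdeal : (Carrier → Set (c ⊔ ℓ)) → Set (c ⊔ ℓ)
  IsPrincipalIdeal I = ∃[ g ] (∀ x → (I x → Divides g x) × (Divides g x → I x))

  IsPID : Set (suc (c ⊔ ℓ))
  IsPID = IsIntegralDomain × (∀ (I : Carrier → Set (c ⊔ ℓ)) → IsIdeal I → IsPrincipalIdeal I)

  CharNot2 : Set ℓ
  CharNot2 = ¬ (two ≈ 0#)

  -- congruence modulo Δ (equality in R/ΔR, elements represented by elements of R)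
  CongMod : Carrier → Carrier → Carrier → Set (c ⊔ ℓ)
  CongMod Δ x y = Divides Δ (x - y)

  UnitMod : Carrier → Carrier → Set (c ⊔ ℓ)
  UnitMod Δ x = ∃[ y ] CongMod Δ (x * y) 1#

  record Form : Set c where
    constructor [_,_,_]
    field
      fa fb fc : Carrier
  open Form public

  eval : Form → Carrier → Carrier → Carrier
  eval q x y = fa q * (x * x) + fb q * (x * y) + fc q * (y * y)

  discriminant : Form → Carrier
  discriminant q = fb q * fb q - four * (fa q * fc q)

  record GL2 : Set (c ⊔ ℓ) where
    field
      α β γ δ : Carrier
      detInv : Carrier
      detInv-inv : (α * δ - β * γ) * detInv ≈ 1#
  open GL2 public

  -- twisted action (M·q)(x,y) = det(M)⁻¹ q(αx+βy, γx+δy), written out coefficientwise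
  act : GL2 → Form → Form
  act M q =
    [ detInv M * (fa q * (α M * α M) + fb q * (α M * γ M) + fc q * (γ M * γ M))
    , detInv M * (two * (fa q * (α M * β M)) + fb q * (α M * δ M + β M * γ M)
                   + two * (fc q * (γ M * δ M)))
    , detInv M * (fa q * (β M * β M) + fb q * (β M * δ M) + fc q * (δ M * δ M)) ]

  FormEq : Form → Form → Set ℓ
  FormEq p q = (fa p ≈ fa q) × (fb p ≈ fb q) × (fc p ≈ fc q)

  Equivalent : Form → Form → Set (c ⊔ ℓ)
  Equivalent p q = ∃[ M ] FormEq p (act M q)

  val : Carrier → Form → Carrier → Set (c ⊔ ℓ)
  val Δ q t = (∃[ x ] ∃[ y ] CongMod Δ (eval q x y) t) × UnitMod Δ t

  ClassValues : Carrier → Form → Carrier → Set (c ⊔ ℓ)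
  ClassValues Δ q t = ∃[ q' ] (Equivalent q' q × val Δ q' t)

  -- principal form [1, π, -(Δ-π²)/4], where Δ = π² + 4k, i.e. (Δ-π²)/4 = k
  principalForm : Carrier → Carrier → Form
  principalForm π k = [ 1# , π , - k ]

-- Acting by M ∈ GL₂(R) multiplies values by det(M)⁻¹ after a linear change of variables, and
-- diag(1, ε⁻¹) realises every unit ε of R.  So the values of the principal class are the units
-- t of R/ΔR with t ≡ ε N(x,y) for a unit ε of R, where N(x,y) = x² + πxy - ky² is the norm form
-- of R[ω], ω² = πω + k.  Multiplicativity of the norm gives closure under products,
-- N(xu,yu) = N(x,y) u² gives inverses (tu ≡ 1 forces u ≡ t u²), and N(u,0) = u² gives the
-- squares.  If 2 is invertible modulo Δ, then 4 N(x,y) = (2x + πy)² - Δ y² makes N(x,y) a square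
-- modulo Δ.

module Submission where

open import Defs
open import Level using (Level; _⊔_)
open import Algebra.Bundles using (CommutativeRing)
open import Data.Product using (∃-syntax; _×_; _,_)
open import Data.Maybe using (nothing)
open import Function.Bundles using (_⇔_; mk⇔; Equivalence)
open import Relation.Binary.Structures using (IsPreorder)

module _ {c ℓ : Level} (R : CommutativeRing c ℓ) where
  open CommutativeRing R
  open import Algebra.Properties.Ring ring using (-1*x≈-x; x[y-z]≈xy-xz; -0#≈0#)
  open import Algebra.Properties.Group +-group using (x≈y⇒x∙y⁻¹≈ε)
  open import Algebra.Properties.AbelianGroup +-abelianGroup using (⁻¹-anti-homo‿-; xyx⁻¹≈y)
  open import Algebra.Properties.CommutativeSemigroup *-commutativeSemigroup
    using (interchange; x∙yz≈yx∙z)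
  open import Algebra.Solver.Ring.NaturalCoefficients commutativeSemiring (λ _ _ → nothing)
  import Relation.Binary.Reasoning.Setoid setoid as ≈-Reasoning
  import Relation.Binary.Reasoning.Base.Double

  Divides-isIdeal : ∀ Δ → IsIdeal R (Divides R Δ)
  Divides-isIdeal Δ = record
    { resp     = λ { x≈y (m , mΔ≈x) → m , trans mΔ≈x x≈y }
    ; has-0    = 0# , zeroˡ Δ
    ; closed-+ = λ { (m , mΔ≈x) (n , nΔ≈y) → m + n , trans (distribʳ Δ m n) (+-cong mΔ≈x nΔ≈y) }
    ; closed-* = λ { r (m , mΔ≈x) → r * m , trans (*-assoc r m Δ) (*-congˡ mΔ≈x) }
    }

  [x-y]+[y-z]≈x-z : ∀ x y z → (x - y) + (y - z) ≈ x - z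
  [x-y]+[y-z]≈x-z x y z = begin
    (x - y) + (y - z)    ≈⟨ +-assoc x (- y) (y - z) ⟩
    x + (- y + (y - z))  ≈⟨ +-congˡ (+-assoc (- y) y (- z)) ⟨
    x + ((- y + y) - z)  ≈⟨ +-congˡ (+-congʳ (-‿inverseˡ y)) ⟩
    x + (0# - z)         ≈⟨ +-congˡ (+-identityˡ (- z)) ⟩
    x - z                ∎
    where open ≈-Reasoning

  module _ (Δ : Carrier) where
    open IsIdeal (Divides-isIdeal Δ)

    ≈⇒CongMod : ∀ {x y} → x ≈ y → CongMod R Δ x y
    ≈⇒CongMod x≈y = resp (sym (x≈y⇒x∙y⁻¹≈ε x≈y)) has-0

    CongMod-sym : ∀ {x y} → CongMod R Δ x y → CongMod R Δ y x
    CongMod-sym {x} {y} x≡y = resp (trans (-1*x≈-x (x - y)) (⁻¹-anti-homo‿- x y)) (closed-* (- 1#) x≡y)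

    CongMod-trans : ∀ {x y z} → CongMod R Δ x y → CongMod R Δ y z → CongMod R Δ x z
    CongMod-trans {x} {y} {z} x≡y y≡z = resp ([x-y]+[y-z]≈x-z x y z) (closed-+ x≡y y≡z)

    CongMod-isPreorder : IsPreorder _≈_ (CongMod R Δ)
    CongMod-isPreorder = record
      { isEquivalence = isEquivalence
      ; reflexive     = ≈⇒CongMod
      ; trans         = CongMod-trans
      }

    module CongMod-Reasoning = Relation.Binary.Reasoning.Base.Double CongMod-isPreorder

    CongMod-*-congˡ : ∀ a {x y} → CongMod R Δ x y → CongMod R Δ (a * x) (a * y)
    CongMod-*-congˡ a {x} {y} x≡y = resp (x[y-z]≈xy-xz a x y) (closed-* a x≡y)

    CongMod-*-cong : ∀ {a b x y} → CongMod R Δ a b → CongMod R Δ x y → CongMod R Δ (a * x) (b * y)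
    CongMod-*-cong {a} {b} {x} {y} a≡b x≡y = begin
      a * x  ≈⟨ *-comm a x ⟩
      x * a  ≲⟨ CongMod-*-congˡ x a≡b ⟩
      x * b  ≈⟨ *-comm x b ⟩
      b * x  ≲⟨ CongMod-*-congˡ b x≡y ⟩
      b * y  ∎
      where open CongMod-Reasoning

    CongMod-+-multiple : ∀ x m → CongMod R Δ (x + m * Δ) x
    CongMod-+-multiple x m = m , sym (xyx⁻¹≈y x (m * Δ))

    UnitMod-resp : ∀ {s t} → CongMod R Δ s t → UnitMod R Δ s → UnitMod R Δ t
    UnitMod-resp s≡t (y , sy≡1) = y , CongMod-trans (CongMod-*-cong (CongMod-sym s≡t) (≈⇒CongMod refl)) sy≡1

    UnitMod-* : ∀ {s t} → UnitMod R Δ s → UnitMod R Δ t → UnitMod R Δ (s * t)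
    UnitMod-* {s} {t} (y , sy≡1) (z , tz≡1) = y * z , (begin
      (s * t) * (y * z)  ≈⟨ interchange s t y z ⟩
      (s * y) * (t * z)  ≲⟨ CongMod-*-cong sy≡1 tz≡1 ⟩
      1# * 1#            ≈⟨ *-identityˡ 1# ⟩
      1#                 ∎)
      where open CongMod-Reasoning

    UnitMod-*⇒UnitModˡ : ∀ {s t} → UnitMod R Δ (s * t) → UnitMod R Δ s
    UnitMod-*⇒UnitModˡ {s} {t} (y , sty≡1) = t * y , CongMod-trans (≈⇒CongMod (sym (*-assoc s t y))) sty≡1

    IsUnit⇒UnitMod : ∀ {ε} → IsUnit R ε → UnitMod R Δ ε
    IsUnit⇒UnitMod (e , εe≈1) = e , ≈⇒CongMod εe≈1

  IsUnit-* : ∀ {s t} → IsUnit R s → IsUnit R t → IsUnit R (s * t)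
  IsUnit-* {s} {t} (y , sy≈1) (z , tz≈1) = y * z , (begin
    (s * t) * (y * z)  ≈⟨ interchange s t y z ⟩
    (s * y) * (t * z)  ≈⟨ *-cong sy≈1 tz≈1 ⟩
    1# * 1#            ≈⟨ *-identityˡ 1# ⟩
    1#                 ∎)
    where open ≈-Reasoning

  eval-cong : ∀ q {x x′ y y′} → x ≈ x′ → y ≈ y′ → eval R q x y ≈ eval R q x′ y′
  eval-cong q x≈x′ y≈y′ =
    +-cong (+-cong (*-congˡ (*-cong x≈x′ x≈x′)) (*-congˡ (*-cong x≈x′ y≈y′))) (*-congˡ (*-cong y≈y′ y≈y′))

  FormEq⇒eval≈ : ∀ {p q} x y → FormEq R p q → eval R p x y ≈ eval R q x y
  FormEq⇒eval≈ x y (a≈a′ , b≈b′ , c≈c′) =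
    +-cong (+-cong (*-congʳ a≈a′) (*-congʳ b≈b′)) (*-congʳ c≈c′)

  eval-act : ∀ M q x y →
    eval R (act R M q) x y ≈ detInv M * eval R q (α M * x + β M * y) (γ M * x + δ M * y)
  eval-act M q x y = identity (detInv M) (fa q) (fb q) (fc q) (α M) (β M) (γ M) (δ M) x y
    where
    identity : ∀ d a b c α β γ δ x y →
      (d * (a * (α * α) + b * (α * γ) + c * (γ * γ))) * (x * x)
      + (d * ((1# + 1#) * (a * (α * β)) + b * (α * δ + β * γ) + (1# + 1#) * (c * (γ * δ)))) * (x * y)
      + (d * (a * (β * β) + b * (β * δ) + c * (δ * δ))) * (y * y)
      ≈ d * (a * ((α * x + β * y) * (α * x + β * y)) + b * ((α * x + β * y) * (γ * x + δ * y))
             + c * ((γ * x + δ * y) * (γ * x + δ * y)))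
    identity = solve 10 (λ d a b c α β γ δ x y →
      (d :* (a :* (α :* α) :+ b :* (α :* γ) :+ c :* (γ :* γ))) :* (x :* x)
      :+ (d :* (con 2 :* (a :* (α :* β)) :+ b :* (α :* δ :+ β :* γ) :+ con 2 :* (c :* (γ :* δ)))) :* (x :* y)
      :+ (d :* (a :* (β :* β) :+ b :* (β :* δ) :+ c :* (δ :* δ))) :* (y :* y)
      := d :* (a :* ((α :* x :+ β :* y) :* (α :* x :+ β :* y)) :+ b :* ((α :* x :+ β :* y) :* (γ :* x :+ δ :* y))
             :+ c :* ((γ :* x :+ δ :* y) :* (γ :* x :+ δ :* y)))) refl

  eval-homogeneous : ∀ q x y u → eval R q (x * u) (y * u) ≈ eval R q x y * (u * u)
  eval-homogeneous q x y u = identity (fa q) (fb q) (fc q) x y u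
    where
    identity : ∀ a b c x y u →
      a * ((x * u) * (x * u)) + b * ((x * u) * (y * u)) + c * ((y * u) * (y * u))
      ≈ (a * (x * x) + b * (x * y) + c * (y * y)) * (u * u)
    identity = solve 6 (λ a b c x y u →
      a :* ((x :* u) :* (x :* u)) :+ b :* ((x :* u) :* (y :* u)) :+ c :* ((y :* u) :* (y :* u))
      := (a :* (x :* x) :+ b :* (x :* y) :+ c :* (y :* y)) :* (u :* u)) refl

  eval-on-x-axis : ∀ q x → eval R q x 0# ≈ fa q * (x * x)
  eval-on-x-axis q x = begin
    fa q * (x * x) + fb q * (x * 0#) + fc q * (0# * 0#)  ≈⟨ +-cong (+-congˡ (trans (*-congˡ (zeroʳ x)) (zeroʳ (fb q))))
                                                                   (trans (*-congˡ (zeroˡ 0#)) (zeroʳ (fc q))) ⟩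
    fa q * (x * x) + 0# + 0#                              ≈⟨ trans (+-identityʳ _) (+-identityʳ _) ⟩
    fa q * (x * x)                                        ∎
    where open ≈-Reasoning

  scaleSecond : ∀ {ε e} → ε * e ≈ 1# → GL2 R
  scaleSecond {ε} {e} εe≈1 = record
    { α = 1# ; β = 0# ; γ = 0# ; δ = e ; detInv = ε
    ; detInv-inv = begin
        (1# * e - 0# * 0#) * ε  ≈⟨ *-congʳ (+-cong (*-identityˡ e) (trans (-‿cong (zeroˡ 0#)) -0#≈0#)) ⟩
        (e + 0#) * ε            ≈⟨ *-congʳ (+-identityʳ e) ⟩
        e * ε                   ≈⟨ *-comm e ε ⟩
        ε * e                   ≈⟨ εe≈1 ⟩
        1#                      ∎
    }
    where open ≈-Reasoning

  eval-act-scaleSecond : ∀ {ε e} (εe≈1 : ε * e ≈ 1#) q x y →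
    eval R (act R (scaleSecond εe≈1) q) x (ε * y) ≈ ε * eval R q x y
  eval-act-scaleSecond {ε} {e} εe≈1 q x y =
    trans (eval-act (scaleSecond εe≈1) q x (ε * y)) (*-congˡ (eval-cong q first second))
    where
    first : 1# * x + 0# * (ε * y) ≈ x
    first = trans (+-cong (*-identityˡ x) (zeroˡ (ε * y))) (+-identityʳ x)
    second : 0# * x + e * (ε * y) ≈ y
    second = begin
      0# * x + e * (ε * y)  ≈⟨ +-cong (zeroˡ x) (x∙yz≈yx∙z e ε y) ⟩
      0# + (ε * e) * y      ≈⟨ +-identityˡ _ ⟩
      (ε * e) * y           ≈⟨ *-congʳ εe≈1 ⟩
      1# * y                ≈⟨ *-identityˡ y ⟩
      y                     ∎
      where open ≈-Reasoning

  UnitMultipleValue : Carrier → Form R → Carrier → Set (c ⊔ ℓ)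
  UnitMultipleValue Δ q t =
    UnitMod R Δ t × ∃[ ε ] ∃[ x ] ∃[ y ] (IsUnit R ε × CongMod R Δ (ε * eval R q x y) t)

  ClassValues⇔UnitMultipleValue : ∀ Δ q t → ClassValues R Δ q t ⇔ UnitMultipleValue Δ q t
  ClassValues⇔UnitMultipleValue Δ q t = mk⇔ to from
    where
    to : ClassValues R Δ q t → UnitMultipleValue Δ q t
    to (q′ , (M , q′≈Mq) , (x , y , q′xy≡t) , t-unit) =
      t-unit , detInv M , _ , _ , (_ , trans (*-comm _ _) (detInv-inv M)) ,
      CongMod-trans Δ (≈⇒CongMod Δ (sym (trans (FormEq⇒eval≈ x y q′≈Mq) (eval-act M q x y)))) q′xy≡t
    from : UnitMultipleValue Δ q t → ClassValues R Δ q t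
    from (t-unit , ε , x , y , (e , εe≈1) , εqxy≡t) =
      act R (scaleSecond εe≈1) q , (scaleSecond εe≈1 , refl , refl , refl) ,
      (x , ε * y , CongMod-trans Δ (≈⇒CongMod Δ (eval-act-scaleSecond εe≈1 q x y)) εqxy≡t) , t-unit

  z≈0⇒x+zy≈x : ∀ {z} → z ≈ 0# → ∀ a p → a + z * p ≈ a
  z≈0⇒x+zy≈x {z} z≈0 a p = begin
    a + z * p   ≈⟨ +-congˡ (trans (*-congʳ z≈0) (zeroˡ p)) ⟩
    a + 0#      ≈⟨ +-identityʳ a ⟩
    a           ∎
    where open ≈-Reasoning

  -- The solver has no negation: these identities are proved with a variable K in place of - k
  -- and hold up to multiples of K + k.
  module _ (π k : Carrier) where
    private
      N : Carrier → Carrier → Carrier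
      N = eval R (principalForm R π k)

      -k+k≈0 : - k + k ≈ 0#
      -k+k≈0 = -‿inverseˡ k

    principalForm-composition : ∀ a b c d →
      N a b * N c d ≈ N (a * c + k * (b * d)) (a * d + b * c + π * (b * d))
    principalForm-composition a b c d = begin
      N a b * N c d                                    ≈⟨ z≈0⇒x+zy≈x -k+k≈0 _ _ ⟨
      N a b * N c d + (- k + k) * P                    ≈⟨ identity a b c d k (- k) π ⟩
      N ac+kbd ad+bc+πbd + (- k + k) * (- k * bbdd)    ≈⟨ z≈0⇒x+zy≈x -k+k≈0 _ _ ⟩
      N ac+kbd ad+bc+πbd                               ∎
      where
      open ≈-Reasoning
      ac+kbd ad+bc+πbd bbdd P : Carrier
      ac+kbd = a * c + k * (b * d)
      ad+bc+πbd = a * d + b * c + π * (b * d)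
      bbdd = b * b * d * d
      P = a * b * d * d * π + b * b * c * d * π + b * b * d * d * k + two R * (a * b * c * d) + b * b * d * d * π * π
      identity : ∀ a b c d k K π →
        (1# * (a * a) + π * (a * b) + K * (b * b)) * (1# * (c * c) + π * (c * d) + K * (d * d))
          + (K + k) * (a * b * d * d * π + b * b * c * d * π + b * b * d * d * k + (1# + 1#) * (a * b * c * d) + b * b * d * d * π * π)
        ≈ (1# * ((a * c + k * (b * d)) * (a * c + k * (b * d))) + π * ((a * c + k * (b * d)) * (a * d + b * c + π * (b * d)))
            + K * ((a * d + b * c + π * (b * d)) * (a * d + b * c + π * (b * d))))
          + (K + k) * (K * (b * b * d * d))
      identity = solve 7 (λ a b c d k K π →
        (con 1 :* (a :* a) :+ π :* (a :* b) :+ K :* (b :* b)) :* (con 1 :* (c :* c) :+ π :* (c :* d) :+ K :* (d :* d))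
          :+ (K :+ k) :* (a :* b :* d :* d :* π :+ b :* b :* c :* d :* π :+ b :* b :* d :* d :* k :+ con 2 :* (a :* b :* c :* d) :+ b :* b :* d :* d :* π :* π)
        := (con 1 :* ((a :* c :+ k :* (b :* d)) :* (a :* c :+ k :* (b :* d))) :+ π :* ((a :* c :+ k :* (b :* d)) :* (a :* d :+ b :* c :+ π :* (b :* d)))
            :+ K :* ((a :* d :+ b :* c :+ π :* (b :* d)) :* (a :* d :+ b :* c :+ π :* (b :* d))))
          :+ (K :+ k) :* (K :* (b :* b :* d :* d))) refl

    principalForm-completeSquare : ∀ x y →
      (two R * x + π * y) * (two R * x + π * y) ≈ four R * N x y + (π * π + four R * k) * (y * y)
    principalForm-completeSquare x y = begin
      L * L                                         ≈⟨ z≈0⇒x+zy≈x -k+k≈0 _ _ ⟨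
      L * L + (- k + k) * (four R * (y * y))        ≈⟨ identity x y k (- k) π ⟩
      four R * N x y + (π * π + four R * k) * (y * y) ∎
      where
      open ≈-Reasoning
      L : Carrier
      L = two R * x + π * y
      identity : ∀ x y k K π →
        ((1# + 1#) * x + π * y) * ((1# + 1#) * x + π * y) + (K + k) * (((1# + 1#) * (1# + 1#)) * (y * y))
        ≈ ((1# + 1#) * (1# + 1#)) * (1# * (x * x) + π * (x * y) + K * (y * y)) + (π * π + ((1# + 1#) * (1# + 1#)) * k) * (y * y)
      identity = solve 5 (λ x y k K π →
        (con 2 :* x :+ π :* y) :* (con 2 :* x :+ π :* y) :+ (K :+ k) :* ((con 2 :* con 2) :* (y :* y))
        := (con 2 :* con 2) :* (con 1 :* (x :* x) :+ π :* (x :* y) :+ K :* (y :* y)) :+ (π :* π :+ (con 2 :* con 2) :* k) :* (y :* y)) refl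

  ClassValues-resp : ∀ Δ q s t → CongMod R Δ s t → ClassValues R Δ q s → ClassValues R Δ q t
  ClassValues-resp Δ q s t s≡t (q′ , q′∼q , (x , y , q′xy≡s) , s-unit) =
    q′ , q′∼q , (x , y , CongMod-trans Δ q′xy≡s s≡t) , UnitMod-resp Δ s≡t s-unit

  UnitTimesSquare : Carrier → Carrier → Set (c ⊔ ℓ)
  UnitTimesSquare Δ t = ∃[ ε ] ∃[ s ] (IsUnit R ε × UnitMod R Δ s × CongMod R Δ t (ε * (s * s)))

  module _ (Δ π k : Carrier) where
    private
      q₀ : Form R
      q₀ = principalForm R π k

      N : Carrier → Carrier → Carrier
      N = eval R q₀

      V : Carrier → Set (c ⊔ ℓ)
      V = UnitMultipleValue Δ q₀

    UnitTimesSquare⇒principalValue : ∀ {t} → UnitTimesSquare Δ t → V t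
    UnitTimesSquare⇒principalValue {t} (ε , s , ε-unit , s-unit , t≡εss) =
      UnitMod-resp Δ (CongMod-sym Δ t≡εss) (UnitMod-* Δ (IsUnit⇒UnitMod Δ ε-unit) (UnitMod-* Δ s-unit s-unit)) ,
      ε , s , 0# , ε-unit , (begin
        ε * N s 0#        ≈⟨ *-congˡ (trans (eval-on-x-axis q₀ s) (*-identityˡ (s * s))) ⟩
        ε * (s * s)       ≲⟨ CongMod-sym Δ t≡εss ⟩
        t                 ∎)
      where open CongMod-Reasoning Δ

    principalValue-square : ∀ {u} → UnitMod R Δ u → V (u * u)
    principalValue-square {u} u-unit =
      UnitTimesSquare⇒principalValue (1# , u , (1# , *-identityˡ 1#) , u-unit , ≈⇒CongMod Δ (sym (*-identityˡ (u * u))))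

    principalValue-* : ∀ {s t} → V s → V t → V (s * t)
    principalValue-* {s} {t} (s-unit , ε , a , b , ε-unit , εNab≡s) (t-unit , η , c , d , η-unit , ηNcd≡t) =
      UnitMod-* Δ s-unit t-unit , ε * η , _ , _ , IsUnit-* ε-unit η-unit , (begin
        (ε * η) * N (a * c + k * (b * d)) (a * d + b * c + π * (b * d))
                                      ≈⟨ *-congˡ (principalForm-composition π k a b c d) ⟨
        (ε * η) * (N a b * N c d)     ≈⟨ interchange ε η (N a b) (N c d) ⟩
        (ε * N a b) * (η * N c d)     ≲⟨ CongMod-*-cong Δ εNab≡s ηNcd≡t ⟩
        s * t                         ∎)
      where open CongMod-Reasoning Δ

    principalValue-inverse : ∀ {t u} → V t → CongMod R Δ (t * u) 1# → V u
    principalValue-inverse {t} {u} (_ , ε , a , b , ε-unit , εNab≡t) tu≡1 =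
      (t , CongMod-trans Δ (≈⇒CongMod Δ (*-comm u t)) tu≡1) , ε , a * u , b * u , ε-unit , (begin
        ε * N (a * u) (b * u)      ≈⟨ *-congˡ (eval-homogeneous q₀ a b u) ⟩
        ε * (N a b * (u * u))      ≈⟨ *-assoc ε (N a b) (u * u) ⟨
        (ε * N a b) * (u * u)      ≲⟨ CongMod-*-cong Δ εNab≡t (≈⇒CongMod Δ refl) ⟩
        t * (u * u)                ≈⟨ *-assoc t u u ⟨
        (t * u) * u                ≲⟨ CongMod-*-cong Δ tu≡1 (≈⇒CongMod Δ refl) ⟩
        1# * u                     ≈⟨ *-identityˡ u ⟩
        u                          ∎)
      where open CongMod-Reasoning Δ

    module _ (Δ≈π²+4k : Δ ≈ π * π + four R * k) where
      completeSquare-mod : ∀ x y →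
        CongMod R Δ ((two R * x + π * y) * (two R * x + π * y)) (four R * N x y)
      completeSquare-mod x y = begin
        (two R * x + π * y) * (two R * x + π * y)        ≈⟨ principalForm-completeSquare π k x y ⟩
        four R * N x y + (π * π + four R * k) * (y * y)  ≈⟨ +-congˡ (trans (*-congʳ (sym Δ≈π²+4k)) (*-comm Δ (y * y))) ⟩
        four R * N x y + (y * y) * Δ                     ≲⟨ CongMod-+-multiple Δ (four R * N x y) (y * y) ⟩
        four R * N x y                                   ∎
        where open CongMod-Reasoning Δ

      principalValue⇒UnitTimesSquare : UnitMod R Δ (two R) → ∀ {t} → V t → UnitTimesSquare Δ t
      principalValue⇒UnitTimesSquare (h , 2h≡1) {t} (t-unit , ε , x , y , ε-unit , εNxy≡t) =
        ε , s , ε-unit , s-unit , CongMod-sym Δ εss≡t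
        where
        open CongMod-Reasoning Δ
        L s : Carrier
        L = two R * x + π * y
        s = h * L

        ss≡N : CongMod R Δ (s * s) (N x y)
        ss≡N = begin
          (h * L) * (h * L)                    ≈⟨ interchange h L h L ⟩
          (h * h) * (L * L)                    ≲⟨ CongMod-*-congˡ Δ (h * h) (completeSquare-mod x y) ⟩
          (h * h) * (four R * N x y)           ≈⟨ rearrange h (two R) (N x y) ⟩
          ((two R * h) * (two R * h)) * N x y  ≲⟨ CongMod-*-cong Δ (CongMod-*-cong Δ 2h≡1 2h≡1) (≈⇒CongMod Δ refl) ⟩
          (1# * 1#) * N x y                    ≈⟨ trans (*-congʳ (*-identityˡ 1#)) (*-identityˡ (N x y)) ⟩
          N x y                                ∎
          where
          rearrange : ∀ h t n → (h * h) * ((t * t) * n) ≈ ((t * h) * (t * h)) * n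
          rearrange = solve 3 (λ h t n → (h :* h) :* ((t :* t) :* n) := ((t :* h) :* (t :* h)) :* n) refl

        εss≡t : CongMod R Δ (ε * (s * s)) t
        εss≡t = CongMod-trans Δ (CongMod-*-congˡ Δ ε ss≡N) εNxy≡t

        s-unit : UnitMod R Δ s
        s-unit = UnitMod-*⇒UnitModˡ Δ (UnitMod-resp Δ (begin
          t                ≲⟨ CongMod-sym Δ εss≡t ⟩
          ε * (s * s)      ≈⟨ *-comm ε (s * s) ⟩
          (s * s) * ε      ≈⟨ *-assoc s s ε ⟩
          s * (s * ε)      ∎) t-unit)

proposition3p3 : ∀ {c ℓ : Level} (R : CommutativeRing c ℓ) → IsPID R → CharNot2 R →
    let open CommutativeRing R in
    ∀ (Δ π k : Carrier) → Δ ≈ π * π + four R * k →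
    let H₀ = ClassValues R Δ (principalForm R π k) in
    ((∀ s t → CongMod R Δ s t → H₀ s → H₀ t)
     × (∀ t → H₀ t → UnitMod R Δ t)
     × H₀ 1#
     × (∀ s t → H₀ s → H₀ t → H₀ (s * t))
     × (∀ t u → H₀ t → CongMod R Δ (t * u) 1# → H₀ u)
     × (∀ u → UnitMod R Δ u → H₀ (u * u)))
    × (UnitMod R Δ (two R) →
        ∀ t → (H₀ t → ∃[ ε ] ∃[ s ] (IsUnit R ε × UnitMod R Δ s × CongMod R Δ t (ε * (s * s))))
            × (∃[ ε ] ∃[ s ] (IsUnit R ε × UnitMod R Δ s × CongMod R Δ t (ε * (s * s))) → H₀ t))
proposition3p3 R _ _ Δ π k Δ≈π²+4k =
  ( ClassValues-resp R Δ q₀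
  , (λ { t (_ , _ , _ , t-unit) → t-unit })
  , ClassValues-resp R Δ q₀ (1# * 1#) 1# (≈⇒CongMod R Δ (*-identityˡ 1#)) (fromV (principalValue-square R Δ π k unit-1#))
  , (λ s t s∈H₀ t∈H₀ → fromV (principalValue-* R Δ π k (toV s∈H₀) (toV t∈H₀)))
  , (λ t u t∈H₀ tu≡1 → fromV (principalValue-inverse R Δ π k (toV t∈H₀) tu≡1))
  , (λ u u-unit → fromV (principalValue-square R Δ π k u-unit)) )
  , λ two-unit t →
      (λ t∈H₀ → principalValue⇒UnitTimesSquare R Δ π k Δ≈π²+4k two-unit (toV t∈H₀))
    , (λ t∈εR² → fromV (UnitTimesSquare⇒principalValue R Δ π k t∈εR²))
  where
  open CommutativeRing R
  q₀ : Form R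
  q₀ = principalForm R π k
  toV : ∀ {t} → ClassValues R Δ q₀ t → UnitMultipleValue R Δ q₀ t
  toV = Equivalence.to (ClassValues⇔UnitMultipleValue R Δ q₀ _)
  fromV : ∀ {t} → UnitMultipleValue R Δ q₀ t → ClassValues R Δ q₀ t
  fromV = Equivalence.from (ClassValues⇔UnitMultipleValue R Δ q₀ _)
  unit-1# : UnitMod R Δ 1#
  unit-1# = 1# , ≈⇒CongMod R Δ (*-identityˡ 1#)
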